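{- Let $A$ be an abelian group equipped with an action of a group $H$. Assume that $H':=\mathrm{im}(H\to\mathrm{Aut}\,A)$ is finite and all its Sylow subgroups are cyclic. Suppose $u\in H^1(H,A)$ has zero restriction to every cyclic subgroup of $H$. Then $u=0$. -}

module Defs where

open import Level using (Level; _⊔_)
open import Algebra.Bundles using (Group; AbelianGroup)
open import Data.Nat using (ℕ; zero; suc; _^_)
open import Data.Nat.Divisibility using (_∣_)
open import Data.Nat.Primality using (Prime)
open import Data.Integer using (ℤ; +_; -[1+_])
open import Data.Fin using (Fin)
open import Data.Product using (Σ; ∃; _×_; _,_)
open import Data.Unit.Polymorphic using (⊤)
open import Relation.Nullary using (¬_)
open import Relation.Binary.PropositionalEquality using (_≡_)

module _ {c ℓ a ℓa : Level} (H : Group c ℓ) (A : AbelianGroup a ℓa) where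
  private
    module H = Group H
    module A = AbelianGroup A

  L : Level
  L = c ⊔ ℓ ⊔ a ⊔ ℓa

  record IsAction (act : H.Carrier → A.Carrier → A.Carrier) : Set L where
    field
      act-cong : ∀ {g h x y} → g H.≈ h → x A.≈ y → act g x A.≈ act h y
      act-ε    : ∀ x → act H.ε x A.≈ x
      act-∙    : ∀ g h x → act (g H.∙ h) x A.≈ act g (act h x)
      act-hom  : ∀ g x y → act g (x A.∙ y) A.≈ (act g x A.∙ act g y)

  powℕ : H.Carrier → ℕ → H.Carrier
  powℕ h zero    = H.ε
  powℕ h (suc n) = h H.∙ powℕ h n

  pow : H.Carrier → ℤ → H.Carrier
  pow h (+ n)      = powℕ h n
  pow h -[1+ n ]   = powℕ (h H.⁻¹) (suc n)

  module _ (act : H.Carrier → A.Carrier → A.Carrier) where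

    _~_ : H.Carrier → H.Carrier → Set (a ⊔ ℓa)
    g ~ h = ∀ x → act g x A.≈ act h x

    -- The subset of H' = im(H → Aut A) given by the images of elements of H
    -- satisfying P is finite of order exactly N: N pairwise distinct images
    -- (as automorphisms) exhausting it.
    HasOrder : (H.Carrier → Set L) → ℕ → Set L
    HasOrder P N = Σ (Fin N → H.Carrier) λ r →
      (∀ i → P (r i)) ×
      (∀ i j → r i ~ r j → i ≡ j) ×
      (∀ h → P h → ∃ λ i → h ~ r i)

    ImageFinite : Set L
    ImageFinite = ∃ λ N → HasOrder (λ _ → ⊤) N

    -- A subgroup of H', described by the set of elements of H mapping into it.
    IsImageSubgroup : (H.Carrier → Set L) → Set L
    IsImageSubgroup P =
      (∀ g h → g ~ h → P g → P h) ×
      P H.ε ×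
      (∀ g h → P g → P h → P (g H.∙ h)) ×
      (∀ g → P g → P (g H.⁻¹))

    IsCyclicImageSubgroup : (H.Carrier → Set L) → Set L
    IsCyclicImageSubgroup P =
      ∃ λ g → P g × (∀ h → P h → ∃ λ (n : ℤ) → h ~ pow g n)

    SylowSubgroupsCyclic : Set (Level.suc L)
    SylowSubgroupsCyclic =
      ∀ N → HasOrder (λ _ → ⊤) N →
      ∀ p → Prime p → ∀ k → (p ^ k) ∣ N → ¬ ((p ^ suc k) ∣ N) →
      ∀ (P : H.Carrier → Set L) → IsImageSubgroup P → HasOrder P (p ^ k) →
      IsCyclicImageSubgroup P

    -- 1-cocycles (crossed homomorphisms) H → A, representing classes in H^1(H,A)
    IsCrossedHom : (H.Carrier → A.Carrier) → Set (c ⊔ ℓ ⊔ ℓa)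
    IsCrossedHom f =
      (∀ {g h} → g H.≈ h → f g A.≈ f h) ×
      (∀ g h → f (g H.∙ h) A.≈ (f g A.∙ act g (f h)))

    ClassZero : (H.Carrier → A.Carrier) → Set (c ⊔ a ⊔ ℓa)
    ClassZero f = ∃ λ x → ∀ g → f g A.≈ (act g x A.∙ (x A.⁻¹))

    RestrictionZero : (H.Carrier → A.Carrier) → H.Carrier → Set (a ⊔ ℓa)
    RestrictionZero f h =
      ∃ λ x → ∀ (n : ℤ) → f (pow h n) A.≈ (act (pow h n) x A.∙ (x A.⁻¹))

-- A cocycle f representing u vanishes on the kernel of the action, so
-- it descends to a cocycle F of the finite group H′ (module ImageGroup).  For a
-- prime p let S be a Sylow p-subgroup of H′ (module Sylow, by Wielandt's
-- counting argument).  S is cyclic, so F restricted to S is a coboundary, and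
-- corestriction (module Transfer) shows that the class of F is killed by the
-- index [H′ : S], which is prime to p.  The integers killing a class are closed
-- under gcd (Bézout, module Coboundaries), so the class of F is killed by 1
-- (Arithmetic.gcd-descent); pulling back along H → H′ gives u = 0.
module Submission where

open import Defs
open import Algebra.Bundles using (Group; AbelianGroup)
open import Data.Fin using (Fin)
open import Data.Product using (_,_)
open import Data.Unit.Polymorphic using (⊤)
open import Relation.Binary.PropositionalEquality using (_≡_)

module Counting where
  open import Algebra.Bundles using (CommutativeMonoid)
  open import Data.Bool using (Bool; true; false; _∧_; not; if_then_else_)
  open import Data.Bool.Properties using (∧-comm; ∧-identityʳ; ∧-zeroʳ)
  open import Data.Nat using (ℕ; zero; suc; _+_; _*_; _≤_; _<_; z≤n; s≤s)
  open import Data.Nat.Properties using (≤-trans; n≤1+n; m≤n+m; +-0-commutativeMonoid)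
  open import Data.Nat.Divisibility using (_∣_; _∣0; ∣m∣n⇒∣m+n)
  open import Data.Fin using (Fin; zero; suc; _≟_)
  open import Relation.Nullary using (does)
  open import Data.Fin.Permutation using (Permutation; _⟨$⟩ʳ_)
  open import Data.Product using (∃; _,_)
  open import Relation.Binary.PropositionalEquality as ≡ using (_≡_)

  count : ∀ {n} → (Fin n → Bool) → ℕ
  count {zero}  b = 0
  count {suc n} b = (if b zero then 1 else 0) + count (λ i → b (suc i))

  module IndicatorSums {a ℓ} (M : CommutativeMonoid a ℓ) where
    open CommutativeMonoid M
      renaming (ε to 0#; ∙-congˡ to +-congˡ; identityˡ to +-identityˡ)
    open import Algebra.Properties.CommutativeMonoid.Sum M public
    open import Algebra.Properties.Monoid.Mult monoid public
    open import Relation.Binary.Reasoning.Setoid setoid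

    infixr 9 _⊙_
    _⊙_ : Bool → Carrier → Carrier
    true  ⊙ x = x
    false ⊙ x = 0#

    ⊙-cong : ∀ b {x y} → x ≈ y → b ⊙ x ≈ b ⊙ y
    ⊙-cong true  x≈y = x≈y
    ⊙-cong false x≈y = refl

    ⊙-∧ : ∀ b c x → b ⊙ (c ⊙ x) ≡ (b ∧ c) ⊙ x
    ⊙-∧ true  c x = ≡.refl
    ⊙-∧ false c x = ≡.refl

    ⊙-sum : ∀ {n} b (f : Fin n → Carrier) → b ⊙ sum f ≈ sum (λ i → b ⊙ f i)
    ⊙-sum     true  f = refl
    ⊙-sum {n} false f = sym (sum-replicate-zero n)

    sum-⊙-const : ∀ {n} (b : Fin n → Bool) x → sum (λ i → b i ⊙ x) ≈ count b × x
    sum-⊙-const {zero}  b x = refl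
    sum-⊙-const {suc n} b x with b zero
    ... | true  = +-congˡ (sum-⊙-const (λ i → b (suc i)) x)
    ... | false = trans (+-identityˡ _) (sum-⊙-const (λ i → b (suc i)) x)

    -- Double counting: if Φ is constant along a relation R, and the predicates
    -- P and P′ each meet every R-"class" exactly once (from the left resp. the
    -- right), then summing Φ over P or over P′ gives the same result.
    module _ {n} (R : Fin n → Fin n → Bool) (P P′ : Fin n → Bool)
             (Φ : Fin n → Carrier)
             (Φ-resp : ∀ t u → R t u ≡ true → Φ t ≈ Φ u)
             (P-unique  : ∀ u → count (λ t → P t ∧ R t u) ≡ 1)
             (P′-unique : ∀ t → count (λ u → R t u ∧ P′ u) ≡ 1) where

      private
        spread : (b : Fin n → Bool) → count b ≡ 1 → ∀ x → x ≈ sum (λ i → b i ⊙ x)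
        spread b cb x = begin
          x                     ≈⟨ sym (×-homo-1 x) ⟩
          1 × x                 ≡⟨ ≡.cong (_× x) (≡.sym cb) ⟩
          count b × x           ≈⟨ sym (sum-⊙-const b x) ⟩
          sum (λ i → b i ⊙ x)   ∎

        via-P′ : ∀ t → Φ t ≈ sum (λ u → (R t u ∧ P′ u) ⊙ Φ u)
        via-P′ t = trans (spread (λ u → R t u ∧ P′ u) (P′-unique t) (Φ t))
                         (sum-cong-≋ (λ u → move u (R t u) ≡.refl))
          where
          move : ∀ u b → R t u ≡ b → (b ∧ P′ u) ⊙ Φ t ≈ (b ∧ P′ u) ⊙ Φ u
          move u true  Rtu = ⊙-cong (P′ u) (Φ-resp t u Rtu)
          move u false Rtu = refl

        swap : ∀ a b c x → a ⊙ ((b ∧ c) ⊙ x) ≡ c ⊙ ((a ∧ b) ⊙ x)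
        swap true  true  true  x = ≡.refl
        swap true  true  false x = ≡.refl
        swap true  false true  x = ≡.refl
        swap true  false false x = ≡.refl
        swap false b     true  x = ≡.refl
        swap false b     false x = ≡.refl

      sum-reindex : sum (λ t → P t ⊙ Φ t) ≈ sum (λ u → P′ u ⊙ Φ u)
      sum-reindex = begin
        sum (λ t → P t ⊙ Φ t)
          ≈⟨ sum-cong-≋ (λ t → trans (⊙-cong (P t) (via-P′ t)) (⊙-sum (P t) (λ u → (R t u ∧ P′ u) ⊙ Φ u))) ⟩
        sum (λ t → sum (λ u → P t ⊙ ((R t u ∧ P′ u) ⊙ Φ u)))
          ≈⟨ ∑-comm (λ t u → P t ⊙ ((R t u ∧ P′ u) ⊙ Φ u)) ⟩
        sum (λ u → sum (λ t → P t ⊙ ((R t u ∧ P′ u) ⊙ Φ u)))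
          ≈⟨ sum-cong-≋ (λ u → reflexive (sum-cong-≗ {n} (λ t → swap (P t) (R t u) (P′ u) (Φ u)))) ⟩
        sum (λ u → sum (λ t → P′ u ⊙ ((P t ∧ R t u) ⊙ Φ u)))
          ≈⟨ sum-cong-≋ (λ u → sym (⊙-sum (P′ u) (λ t → (P t ∧ R t u) ⊙ Φ u))) ⟩
        sum (λ u → P′ u ⊙ sum (λ t → (P t ∧ R t u) ⊙ Φ u))
          ≈⟨ sum-cong-≋ (λ u → ⊙-cong (P′ u) (sym (spread (λ t → P t ∧ R t u) (P-unique u) (Φ u)))) ⟩
        sum (λ u → P′ u ⊙ Φ u) ∎

  open ≡ using (refl; sym; trans; cong)

  module ℕSum = IndicatorSums +-0-commutativeMonoid
  open ℕSum using (_⊙_; sum)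

  count≡sum : ∀ {n} (b : Fin n → Bool) → count b ≡ sum (λ i → b i ⊙ 1)
  count≡sum {zero}  b = refl
  count≡sum {suc n} b with b zero
  ... | true  = cong suc (count≡sum (λ i → b (suc i)))
  ... | false = count≡sum (λ i → b (suc i))

  sum-⊙ : ∀ {n} (b : Fin n → Bool) (c : ℕ) → sum (λ i → b i ⊙ c) ≡ count b * c
  sum-⊙ {zero}  b c = refl
  sum-⊙ {suc n} b c with b zero
  ... | true  = cong (c +_) (sum-⊙ (λ i → b (suc i)) c)
  ... | false = sum-⊙ (λ i → b (suc i)) c

  count-cong : ∀ {n} {b c : Fin n → Bool} → (∀ i → b i ≡ c i) → count b ≡ count c
  count-cong {b = b} {c} b≗c =
    trans (count≡sum b) (trans (ℕSum.sum-cong-≗ (λ i → cong (_⊙ 1) (b≗c i))) (sym (count≡sum c)))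

  count-permute : ∀ {n} (b : Fin n → Bool) (π : Permutation n n) →
                  count b ≡ count (λ i → b (π ⟨$⟩ʳ i))
  count-permute b π =
    trans (count≡sum b) (trans (ℕSum.sum-permute _ π) (sym (count≡sum (λ i → b (π ⟨$⟩ʳ i)))))

  count-mono : ∀ {n} {b c : Fin n → Bool} → (∀ i → b i ≡ true → c i ≡ true) → count b ≤ count c
  count-mono {zero}  b⇒c = z≤n
  count-mono {suc n} {b} {c} b⇒c with b zero in b₀ | c zero in c₀
  ... | true  | true  = s≤s (count-mono (λ i → b⇒c (suc i)))
  ... | true  | false with () ← trans (sym (b⇒c zero b₀)) c₀
  ... | false | true  = ≤-trans (count-mono (λ i → b⇒c (suc i))) (n≤1+n _)
  ... | false | false = count-mono (λ i → b⇒c (suc i))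

  count-none : ∀ {n} {b : Fin n → Bool} → (∀ i → b i ≡ false) → count b ≡ 0
  count-none {zero}      none = refl
  count-none {suc n} {b} none rewrite none zero = count-none (λ i → none (suc i))

  count-all : ∀ {n} {b : Fin n → Bool} → (∀ i → b i ≡ true) → count b ≡ n
  count-all {zero}      all = refl
  count-all {suc n} {b} all rewrite all zero = cong suc (count-all (λ i → all (suc i)))

  count>0 : ∀ {n} (b : Fin n → Bool) → 0 < count b → ∃ λ i → b i ≡ true
  count>0 {suc n} b pos with b zero in b₀
  ... | true  = zero , b₀
  ... | false with count>0 (λ i → b (suc i)) pos
  ... | i , bi = suc i , bi

  count>0-intro : ∀ {n} (b : Fin n → Bool) i → b i ≡ true → 0 < count b
  count>0-intro {suc n} b zero    bi rewrite bi = s≤s z≤n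
  count>0-intro {suc n} b (suc i) bi = ≤-trans (count>0-intro (λ j → b (suc j)) i bi) (m≤n+m _ _)

  ∣-sum : ∀ {n} d (f : Fin n → ℕ) → (∀ i → d ∣ f i) → d ∣ sum f
  ∣-sum {zero}  d f d∣f = d ∣0
  ∣-sum {suc n} d f d∣f = ∣m∣n⇒∣m+n (d∣f zero) (∣-sum d (λ i → f (suc i)) (λ i → d∣f (suc i)))

  count-singleton : ∀ {n} (x : Fin n) → count (λ j → does (x ≟ j)) ≡ 1
  count-singleton {suc n} zero    = cong suc (count-none {n} {λ j → does (zero ≟ suc j)} (λ j → refl))
  count-singleton {suc n} (suc x) = count-singleton x

  noneBefore : ∀ {n} → (Fin n → Bool) → Fin n → Bool
  noneBefore Q zero    = true
  noneBefore Q (suc t) = not (Q zero) ∧ noneBefore (λ v → Q (suc v)) t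

  noneBefore-cong : ∀ {n} {Q Q′ : Fin n → Bool} → (∀ v → Q v ≡ Q′ v) →
                    ∀ t → noneBefore Q t ≡ noneBefore Q′ t
  noneBefore-cong Q≗Q′ zero = refl
  noneBefore-cong Q≗Q′ (suc t) rewrite Q≗Q′ zero =
    cong (_ ∧_) (noneBefore-cong (λ v → Q≗Q′ (suc v)) t)

  count-first : ∀ {n} (Q : Fin n → Bool) → ∃ (λ t → Q t ≡ true) →
                count (λ t → Q t ∧ noneBefore Q t) ≡ 1
  count-first {suc n} Q (t , Qt) with Q zero in Q₀
  ... | true = cong suc (count-none (λ i → ∧-zeroʳ (Q (suc i))))
  count-first {suc n} Q (zero  , Qt) | false with () ← trans (sym Q₀) Qt
  count-first {suc n} Q (suc t , Qt) | false = count-first (λ v → Q (suc v)) (t , Qt)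

  -- Representatives of the classes of a decidable equivalence relation on
  -- Fin n: the least element of each class.
  module Representatives {n} (R : Fin n → Fin n → Bool)
    (R-refl  : ∀ t → R t t ≡ true)
    (R-sym   : ∀ t u → R t u ≡ true → R u t ≡ true)
    (R-trans : ∀ t u v → R t u ≡ true → R u v ≡ true → R t v ≡ true) where
    open ≡.≡-Reasoning

    private
      bool-ext : ∀ {a b : Bool} → (a ≡ true → b ≡ true) → (b ≡ true → a ≡ true) → a ≡ b
      bool-ext {true}  {true}  a⇒b b⇒a = refl
      bool-ext {true}  {false} a⇒b b⇒a = sym (a⇒b refl)
      bool-ext {false} {true}  a⇒b b⇒a = b⇒a refl
      bool-ext {false} {false} a⇒b b⇒a = refl

    rep : Fin n → Bool
    rep t = noneBefore (λ v → R v t) t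

    rep-unique : ∀ u → count (λ t → rep t ∧ R t u) ≡ 1
    rep-unique u = trans (count-cong same) (count-first (λ v → R v u) (u , R-refl u))
      where
      same : ∀ t → (rep t ∧ R t u) ≡ (R t u ∧ noneBefore (λ v → R v u) t)
      same t with R t u in Rtu
      ... | false = ∧-zeroʳ (rep t)
      ... | true  = trans (∧-identityʳ (rep t)) (noneBefore-cong
          (λ v → bool-ext (λ Rvt → R-trans v t u Rvt Rtu) (λ Rvu → R-trans v u t Rvu (R-sym t u Rtu))) t)

    rep-unique′ : ∀ t → count (λ u → R t u ∧ rep u) ≡ 1
    rep-unique′ t = trans (count-cong flip) (rep-unique t)
      where
      flip : ∀ u → (R t u ∧ rep u) ≡ (rep u ∧ R u t)
      flip u = trans (∧-comm (R t u) (rep u)) (cong (rep u ∧_) (bool-ext (R-sym t u) (R-sym u t)))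

    private
      swap : ∀ a b c → a ⊙ ((b ∧ c) ⊙ 1) ≡ b ⊙ ((c ∧ a) ⊙ 1)
      swap true  true  true  = refl
      swap true  true  false = refl
      swap true  false c     = refl
      swap false true  true  = refl
      swap false true  false = refl
      swap false false c     = refl

    count-by-classes : ∀ Q → count Q ≡ sum (λ t → rep t ⊙ count (λ u → R t u ∧ Q u))
    count-by-classes Q = begin
      count Q
        ≡⟨ count≡sum Q ⟩
      sum (λ u → Q u ⊙ 1)
        ≡⟨ ℕSum.sum-cong-≗ (λ u → cong (Q u ⊙_) (trans (sym (rep-unique u)) (count≡sum (λ t → rep t ∧ R t u)))) ⟩
      sum (λ u → Q u ⊙ sum (λ t → (rep t ∧ R t u) ⊙ 1))
        ≡⟨ ℕSum.sum-cong-≗ (λ u → ℕSum.⊙-sum (Q u) (λ t → (rep t ∧ R t u) ⊙ 1)) ⟩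
      sum (λ u → sum (λ t → Q u ⊙ ((rep t ∧ R t u) ⊙ 1)))
        ≡⟨ ℕSum.∑-comm (λ u t → Q u ⊙ ((rep t ∧ R t u) ⊙ 1)) ⟩
      sum (λ t → sum (λ u → Q u ⊙ ((rep t ∧ R t u) ⊙ 1)))
        ≡⟨ ℕSum.sum-cong-≗ (λ t → ℕSum.sum-cong-≗ (λ u → swap (Q u) (rep t) (R t u))) ⟩
      sum (λ t → sum (λ u → rep t ⊙ ((R t u ∧ Q u) ⊙ 1)))
        ≡⟨ ℕSum.sum-cong-≗ (λ t → sym (trans (cong (rep t ⊙_) (count≡sum (λ u → R t u ∧ Q u)))
                                              (ℕSum.⊙-sum (rep t) (λ u → (R t u ∧ Q u) ⊙ 1)))) ⟩
      sum (λ t → rep t ⊙ count (λ u → R t u ∧ Q u)) ∎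


module Enumerations where
  open Counting using (count)
  open import Data.Bool using (Bool; true; false)
  open import Data.Nat using (ℕ; zero; suc)
  open import Data.Fin using (Fin; zero; suc)
  open import Data.Fin.Properties using (suc-injective)
  open import Data.Product using (Σ; ∃; _×_; _,_)
  open import Relation.Binary.PropositionalEquality using (_≡_; refl; sym; trans; cong)

  Enumeration : ∀ {n} → (Fin n → Bool) → ℕ → Set
  Enumeration {n} b c = Σ (Fin c → Fin n) λ en →
    (∀ i → b (en i) ≡ true) × (∀ i j → en i ≡ en j → i ≡ j) × (∀ x → b x ≡ true → ∃ λ i → en i ≡ x)

  enumerate : ∀ {n} (b : Fin n → Bool) → Enumeration b (count b)
  enumerate {zero}  b = (λ ()) , (λ ()) , (λ ()) , (λ ())
  enumerate {suc n} b with b zero in b₀ | enumerate (λ i → b (suc i))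
  ... | true | en , en∈ , en-inj , en-onto = en′ , en′∈ , en′-inj , en′-onto
    where
    en′ : Fin (suc (count (λ i → b (suc i)))) → Fin (suc n)
    en′ zero    = zero
    en′ (suc i) = suc (en i)
    en′∈ : ∀ i → b (en′ i) ≡ true
    en′∈ zero    = b₀
    en′∈ (suc i) = en∈ i
    en′-inj : ∀ i j → en′ i ≡ en′ j → i ≡ j
    en′-inj zero    zero    _  = refl
    en′-inj (suc i) (suc j) eq = cong suc (en-inj i j (suc-injective eq))
    en′-onto : ∀ x → b x ≡ true → ∃ λ i → en′ i ≡ x
    en′-onto zero    _  = zero , refl
    en′-onto (suc x) bx with en-onto x bx
    ... | i , eq = suc i , cong suc eq
  ... | false | en , en∈ , en-inj , en-onto =
    (λ i → suc (en i)) , en∈ , (λ i j eq → en-inj i j (suc-injective eq)) , en′-onto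
    where
    en′-onto : ∀ x → b x ≡ true → ∃ λ i → suc (en i) ≡ x
    en′-onto zero    b0 with () ← trans (sym b₀) b0
    en′-onto (suc x) bx with en-onto x bx
    ... | i , eq = i , cong suc eq

module FiniteGroups where
  open Counting
  open ℕSum using (_⊙_; sum)
  open import Algebra.Bundles using (Group)
  open import Algebra.Structures using (IsGroup)
  open import Data.Bool using (Bool; true; _∧_)
  open import Data.Bool.Properties using (∧-identityʳ)
  open import Data.Nat using (ℕ; _*_)
  open import Data.Fin using (Fin)
  open import Data.Fin.Permutation using (Permutation; permutation)
  open import Level using (0ℓ)
  open import Relation.Binary.PropositionalEquality as ≡
    using (_≡_; refl; sym; trans; cong; subst)
  open ≡.≡-Reasoning

  record FinGroup (N : ℕ) : Set where
    field
      op      : Fin N → Fin N → Fin N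
      e       : Fin N
      inv     : Fin N → Fin N
      isGroup : IsGroup _≡_ op e inv

    group : Group 0ℓ 0ℓ
    group = record { isGroup = isGroup }

    open IsGroup isGroup public using (assoc; identityˡ; identityʳ; inverseˡ; inverseʳ)
    open import Algebra.Properties.Group group public
      using (ε⁻¹≈ε; ⁻¹-involutive; ⁻¹-anti-homo-∙)

    cancelˡ : ∀ a b → op (inv a) (op a b) ≡ b
    cancelˡ a b = trans (sym (assoc (inv a) a b)) (trans (cong (λ z → op z b) (inverseˡ a)) (identityˡ b))

    cancelʳ : ∀ a b → op a (op (inv a) b) ≡ b
    cancelʳ a b = trans (sym (assoc a (inv a) b)) (trans (cong (λ z → op z b) (inverseʳ a)) (identityˡ b))

    translateˡ : Fin N → Permutation N N
    translateˡ g = permutation (op g) (op (inv g)) (cancelʳ g) (cancelˡ g)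

    translateʳ : Fin N → Permutation N N
    translateʳ g = permutation (λ x → op x g) (λ x → op x (inv g)) back forth
      where
      back : ∀ x → op (op x (inv g)) g ≡ x
      back x = trans (assoc x (inv g) g) (trans (cong (op x) (inverseˡ g)) (identityʳ x))
      forth : ∀ x → op (op x g) (inv g) ≡ x
      forth x = trans (assoc x g (inv g)) (trans (cong (op x) (inverseʳ g)) (identityʳ x))

  record IsSubgroup {N} (G : FinGroup N) (S : Fin N → Bool) : Set where
    open FinGroup G
    field
      e∈   : S e ≡ true
      op∈  : ∀ a b → S a ≡ true → S b ≡ true → S (op a b) ≡ true
      inv∈ : ∀ a → S a ≡ true → S (inv a) ≡ true

  module Cosets {N} (G : FinGroup N) {S : Fin N → Bool} (sub : IsSubgroup G S) where
    open FinGroup G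
    open IsSubgroup sub

    R : Fin N → Fin N → Bool
    R t u = S (op (inv t) u)

    R-refl : ∀ t → R t t ≡ true
    R-refl t = trans (cong S (inverseˡ t)) e∈

    R-sym : ∀ t u → R t u ≡ true → R u t ≡ true
    R-sym t u Rtu = subst (λ z → S z ≡ true) inv-quotient (inv∈ _ Rtu)
      where
      inv-quotient : inv (op (inv t) u) ≡ op (inv u) t
      inv-quotient = trans (⁻¹-anti-homo-∙ (inv t) u) (cong (op (inv u)) (⁻¹-involutive t))

    R-trans : ∀ t u v → R t u ≡ true → R u v ≡ true → R t v ≡ true
    R-trans t u v Rtu Ruv = subst (λ z → S z ≡ true) telescope (op∈ _ _ Rtu Ruv)
      where
      telescope : op (op (inv t) u) (op (inv u) v) ≡ op (inv t) v
      telescope = trans (assoc (inv t) u (op (inv u) v)) (cong (op (inv t)) (cancelʳ u v))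

    open Representatives R R-refl R-sym R-trans public

    translated-rep-unique : ∀ g u → count (λ t → rep (op (inv g) t) ∧ R t u) ≡ 1
    translated-rep-unique g u =
      trans (count-permute _ (translateˡ g))
            (trans (count-cong (λ t → ≡.cong₂ _∧_ (cong rep (cancelˡ g t)) (shift t)))
                   (rep-unique (op (inv g) u)))
      where
      shift : ∀ t → R (op g t) u ≡ R t (op (inv g) u)
      shift t = cong S (trans (cong (λ z → op z u) (⁻¹-anti-homo-∙ g t)) (assoc (inv t) (inv g) u))

    coset-size : ∀ t → count (R t) ≡ count S
    coset-size t = trans (count-permute (R t) (translateˡ t)) (count-cong (λ u → cong S (cancelˡ t u)))

    index : ℕ
    index = count rep

    lagrange : index * count S ≡ N
    lagrange = begin
      count rep * count S                             ≡⟨ sym (sum-⊙ rep (count S)) ⟩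
      sum (λ t → rep t ⊙ count S)                     ≡⟨ ℕSum.sum-cong-≗ (λ t → cong (rep t ⊙_) (sym whole-coset)) ⟩
      sum (λ t → rep t ⊙ count (λ u → R t u ∧ true))  ≡⟨ sym (count-by-classes (λ _ → true)) ⟩
      count {N} (λ _ → true)                          ≡⟨ count-all (λ _ → refl) ⟩
      N                                               ∎
      where
      whole-coset : ∀ {t} → count (λ u → R t u ∧ true) ≡ count S
      whole-coset {t} = trans (count-cong (λ u → ∧-identityʳ (R t u))) (coset-size t)

module Coboundaries {c ℓ a ℓa} (H : Group c ℓ) (A : AbelianGroup a ℓa)
  (act : Group.Carrier H → AbelianGroup.Carrier A → AbelianGroup.Carrier A)
  (isAction : IsAction H A act) where
  open import Data.Nat as ℕ using (ℕ; zero; suc)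
  open import Data.Nat.GCD using (gcd; gcd-GCD; module Bézout)
  open import Data.Product using (_,_)
  open import Relation.Binary.PropositionalEquality as ≡ using (_≡_)
  private module H = Group H
  open AbelianGroup A
    renaming (_∙_ to _+_; ε to 0#; _⁻¹ to -_; ∙-cong to +-cong;
              ∙-congˡ to +-congˡ; ∙-congʳ to +-congʳ; identityʳ to +-identityʳ;
              inverseʳ to -‿inverseʳ)
  open IsAction isAction
  open import Algebra.Properties.Group group using (inverseʳ-unique; ε⁻¹≈ε; loop)
  open import Algebra.Properties.Loop loop using (identityʳ-unique)
  open import Algebra.Properties.AbelianGroup A using (⁻¹-∙-comm)
  open import Algebra.Properties.Monoid.Mult monoid using (_×_; ×-homo-+; ×-assocˡ; ×-congʳ)
  open import Algebra.Properties.CommutativeMonoid.Mult commutativeMonoid using (×-distrib-+)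
  open import Algebra.Solver.CommutativeMonoid commutativeMonoid using (solve; _⊕_; _⊜_)
  open import Relation.Binary.Reasoning.Setoid setoid

  act-0 : ∀ g → act g 0# ≈ 0#
  act-0 g = identityʳ-unique (act g 0#) (act g 0#)
    (trans (sym (act-hom g 0# 0#)) (act-cong H.refl (+-identityʳ 0#)))

  act-neg : ∀ g x → act g (- x) ≈ - act g x
  act-neg g x = inverseʳ-unique (act g x) (act g (- x))
    (trans (sym (act-hom g x (- x))) (trans (act-cong H.refl (-‿inverseʳ x)) (act-0 g)))

  act-× : ∀ g n x → act g (n × x) ≈ n × act g x
  act-× g zero    x = act-0 g
  act-× g (suc n) x = trans (act-hom g _ _) (+-congˡ (act-× g n x))

  ×-neg : ∀ n x → n × (- x) ≈ - (n × x)
  ×-neg zero    x = sym ε⁻¹≈ε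
  ×-neg (suc n) x = trans (+-congˡ (×-neg n x)) (⁻¹-∙-comm x (n × x))

  KilledBy : (Group.Carrier H → Carrier) → ℕ → Set _
  KilledBy f d = ClassZero H A act (λ g → d × f g)

  module _ (f : Group.Carrier H → Carrier) where

    killedBy-* : ∀ k d → KilledBy f d → KilledBy f (k ℕ.* d)
    killedBy-* k d (y , dF≈δy) = k × y , λ g → begin
      (k ℕ.* d) × f g          ≈⟨ sym (×-assocˡ (f g) k d) ⟩
      k × (d × f g)            ≈⟨ ×-congʳ k (dF≈δy g) ⟩
      k × (act g y + - y)      ≈⟨ ×-distrib-+ _ _ k ⟩
      k × act g y + k × (- y)  ≈⟨ +-cong (sym (act-× g k y)) (×-neg k y) ⟩
      act g (k × y) + - (k × y) ∎

    killedBy-∸ : ∀ d e → KilledBy f (d ℕ.+ e) → KilledBy f e → KilledBy f d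
    killedBy-∸ d e (y₁ , h₁) (y₂ , h₂) = y₁ + - y₂ , λ g → begin
      d × f g
        ≈⟨ sym (trans (+-congˡ (-‿inverseʳ (e × f g))) (+-identityʳ _)) ⟩
      d × f g + (e × f g + - (e × f g))
        ≈⟨ solve 3 (λ a b c → a ⊕ (b ⊕ c) ⊜ (a ⊕ b) ⊕ c) refl (d × f g) (e × f g) (- (e × f g)) ⟩
      (d × f g + e × f g) + - (e × f g)
        ≈⟨ +-cong (sym (×-homo-+ (f g) d e)) (⁻¹-cong (h₂ g)) ⟩
      (d ℕ.+ e) × f g + - (act g y₂ + - y₂)
        ≈⟨ +-cong (h₁ g) (sym (⁻¹-∙-comm _ _)) ⟩
      (act g y₁ + - y₁) + (- act g y₂ + - - y₂)
        ≈⟨ solve 4 (λ a b c d → (a ⊕ b) ⊕ (c ⊕ d) ⊜ (a ⊕ c) ⊕ (b ⊕ d)) refl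
                   (act g y₁) (- y₁) (- act g y₂) (- - y₂) ⟩
      (act g y₁ + - act g y₂) + (- y₁ + - - y₂)
        ≈⟨ +-cong (+-congˡ (sym (act-neg g y₂))) (⁻¹-∙-comm _ _) ⟩
      (act g y₁ + act g (- y₂)) + - (y₁ + - y₂)
        ≈⟨ +-congʳ (sym (act-hom g _ _)) ⟩
      act g (y₁ + - y₂) + - (y₁ + - y₂) ∎

    killedBy-gcd : ∀ m n → KilledBy f m → KilledBy f n → KilledBy f (gcd m n)
    killedBy-gcd m n km kn with Bézout.identity (gcd-GCD m n)
    ... | Bézout.+- x y eq =
      killedBy-∸ (gcd m n) (y ℕ.* n) (≡.subst (KilledBy f) (≡.sym eq) (killedBy-* x m km)) (killedBy-* y n kn)
    ... | Bézout.-+ x y eq =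
      killedBy-∸ (gcd m n) (x ℕ.* m) (≡.subst (KilledBy f) (≡.sym eq) (killedBy-* y n kn)) (killedBy-* x m km)

-- Corestriction for finite groups: if a cocycle becomes a coboundary on a
-- subgroup S, then its class is killed by the index [G : S].
module Transfer {N a ℓa} (G : FiniteGroups.FinGroup N) (A : AbelianGroup a ℓa)
  (α : Fin N → AbelianGroup.Carrier A → AbelianGroup.Carrier A)
  (isAction : IsAction (FiniteGroups.FinGroup.group G) A α)
  (F : Fin N → AbelianGroup.Carrier A)
  (cocycle : IsCrossedHom (FiniteGroups.FinGroup.group G) A α F) where
  open Counting
  open FiniteGroups
  open FinGroup G using (group; op; inv; cancelˡ; translateˡ)
  open import Data.Bool using (Bool; true; false)
  open import Data.Nat using (zero; suc)
  open import Data.Fin using (zero; suc)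
  open import Data.Product using (_,_; proj₂)
  open import Relation.Binary.PropositionalEquality as ≡ using (_≡_)
  open AbelianGroup A hiding (group)
    renaming (_∙_ to _+_; ε to 0#; _⁻¹ to -_; ∙-cong to +-cong;
              ∙-congˡ to +-congˡ; ∙-congʳ to +-congʳ; identityˡ to +-identityˡ;
              identityʳ to +-identityʳ; inverseˡ to -‿inverseˡ; inverseʳ to -‿inverseʳ)
  open import Algebra.Properties.AbelianGroup A using (⁻¹-involutive; ⁻¹-∙-comm)
  open import Algebra.Solver.CommutativeMonoid commutativeMonoid using (solve; _⊕_; _⊜_)
  open import Relation.Binary.Reasoning.Setoid setoid
  module ASum = IndicatorSums commutativeMonoid
  open ASum using (_⊙_; sum; _×_)

  open IsAction isAction
  open Coboundaries group A α isAction using (act-0; act-neg; ×-neg; KilledBy)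
  private
    F-op : ∀ g h → F (op g h) ≈ F g + α g (F h)
    F-op = proj₂ cocycle

  act-⊙ : ∀ g b x → α g (b ⊙ x) ≈ b ⊙ α g x
  act-⊙ g true  x = refl
  act-⊙ g false x = act-0 g

  act-sum : ∀ g {n} (f : Fin n → Carrier) → α g (sum f) ≈ sum (λ i → α g (f i))
  act-sum g {zero}  f = act-0 g
  act-sum g {suc n} f = trans (act-hom g _ _) (+-congˡ (act-sum g (λ i → f (suc i))))

  ⊙-+ : ∀ b x y → b ⊙ (x + y) ≈ b ⊙ x + b ⊙ y
  ⊙-+ true  x y = refl
  ⊙-+ false x y = sym (+-identityʳ 0#)

  act-F : ∀ g t → α g (F t) ≈ - F g + F (op g t)
  act-F g t = begin
    α g (F t)                  ≈⟨ sym (+-identityˡ _) ⟩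
    0# + α g (F t)             ≈⟨ +-congʳ (sym (-‿inverseˡ (F g))) ⟩
    (- F g + F g) + α g (F t)  ≈⟨ assoc _ _ _ ⟩
    - F g + (F g + α g (F t))  ≈⟨ +-congˡ (sym (F-op g t)) ⟩
    - F g + F (op g t)         ∎

  module _ {S : Fin N → Bool} (sub : IsSubgroup G S) (x : Carrier)
           (F≈δx : ∀ s → S s ≡ true → F s ≈ α s x + - x) where
    open Cosets G sub using (R; rep; index; rep-unique′; translated-rep-unique)

    -- Φ t = F t - t·x depends only on the coset tS
    Φ : Fin N → Carrier
    Φ t = F t + - α t x

    Φ-op : ∀ t s → S s ≡ true → Φ (op t s) ≈ Φ t
    Φ-op t s s∈S = begin
      F (op t s) + - α (op t s) x                 ≈⟨ +-cong (F-op t s) (⁻¹-cong (act-∙ t s x)) ⟩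
      (F t + α t (F s)) + - α t (α s x)            ≈⟨ +-congʳ (+-congˡ (act-cong ≡.refl (F≈δx s s∈S))) ⟩
      (F t + α t (α s x + - x)) + - α t (α s x)    ≈⟨ +-congʳ (+-congˡ (trans (act-hom t _ _) (+-congˡ (act-neg t x)))) ⟩
      (F t + (α t (α s x) + - α t x)) + - α t (α s x)
        ≈⟨ solve 4 (λ f a b c → (f ⊕ (a ⊕ b)) ⊕ c ⊜ (f ⊕ b) ⊕ (a ⊕ c)) refl (F t) (α t (α s x)) (- α t x) (- α t (α s x)) ⟩
      (F t + - α t x) + (α t (α s x) + - α t (α s x)) ≈⟨ trans (+-congˡ (-‿inverseʳ _)) (+-identityʳ _) ⟩
      F t + - α t x                                ∎

    Φ-coset : ∀ t u → R t u ≡ true → Φ t ≈ Φ u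
    Φ-coset t u tu = sym (trans (reflexive (≡.cong Φ (≡.sym (FinGroup.cancelʳ G t u)))) (Φ-op t (op (inv t) u) tu))

    act-Φ : ∀ g t → α g (Φ t) ≈ Φ (op g t) + - F g
    act-Φ g t = begin
      α g (F t + - α t x)                     ≈⟨ act-hom g _ _ ⟩
      α g (F t) + α g (- α t x)               ≈⟨ +-cong (act-F g t) (trans (act-neg g _) (⁻¹-cong (sym (act-∙ g t x)))) ⟩
      (- F g + F (op g t)) + - α (op g t) x
        ≈⟨ solve 3 (λ a b c → (a ⊕ b) ⊕ c ⊜ (b ⊕ c) ⊕ a) refl (- F g) (F (op g t)) (- α (op g t) x) ⟩
      (F (op g t) + - α (op g t) x) + - F g   ∎

    -- the transfer element: Φ summed over a set of coset representatives
    w : Carrier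
    w = sum (λ t → rep t ⊙ Φ t)

    -- g permutes the cosets, so {g t | t a representative} is again a set
    -- of representatives, and summing Φ over it gives w again
    w-translate : ∀ g → sum (λ t → rep t ⊙ Φ (op g t)) ≈ w
    w-translate g = begin
      sum (λ t → rep t ⊙ Φ (op g t))
        ≈⟨ reflexive (ASum.sum-cong-≗ {N} (λ t → ≡.cong (λ z → rep z ⊙ Φ (op g t)) (≡.sym (cancelˡ g t)))) ⟩
      sum (λ t → rep (op (inv g) (op g t)) ⊙ Φ (op g t))
        ≈⟨ sym (ASum.sum-permute (λ t → rep (op (inv g) t) ⊙ Φ t) (translateˡ g)) ⟩
      sum (λ t → rep (op (inv g) t) ⊙ Φ t)
        ≈⟨ ASum.sum-reindex R (λ t → rep (op (inv g) t)) rep Φ Φ-coset (translated-rep-unique g) rep-unique′ ⟩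
      w ∎

    -- so g moves w by index × F g; hence -w trivialises index × F
    act-w : ∀ g → α g w ≈ w + - (index × F g)
    act-w g = begin
      α g w                                                  ≈⟨ act-sum g {N} _ ⟩
      sum (λ t → α g (rep t ⊙ Φ t))                          ≈⟨ ASum.sum-cong-≋ (λ t → trans (act-⊙ g (rep t) (Φ t)) (ASum.⊙-cong (rep t) (act-Φ g t))) ⟩
      sum (λ t → rep t ⊙ (Φ (op g t) + - F g))               ≈⟨ ASum.sum-cong-≋ (λ t → ⊙-+ (rep t) _ _) ⟩
      sum (λ t → rep t ⊙ Φ (op g t) + rep t ⊙ (- F g))       ≈⟨ ASum.∑-distrib-+ {N} _ _ ⟩
      sum (λ t → rep t ⊙ Φ (op g t)) + sum (λ t → rep t ⊙ (- F g)) ≈⟨ +-cong (w-translate g) (ASum.sum-⊙-const rep (- F g)) ⟩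
      w + index × (- F g)                                    ≈⟨ +-congˡ (×-neg index (F g)) ⟩
      w + - (index × F g)                                    ∎

    transfer : KilledBy F index
    transfer = - w , λ g → let c = index × F g in sym (begin
      α g (- w) + - (- w)        ≈⟨ +-cong (trans (act-neg g w) (⁻¹-cong (act-w g))) (⁻¹-involutive w) ⟩
      - (w + - c) + w            ≈⟨ +-congʳ (sym (⁻¹-∙-comm w (- c))) ⟩
      (- w + - (- c)) + w        ≈⟨ +-congʳ (+-congˡ (⁻¹-involutive c)) ⟩
      (- w + c) + w              ≈⟨ solve 3 (λ a b c → (a ⊕ b) ⊕ c ⊜ b ⊕ (a ⊕ c)) refl (- w) c w ⟩
      c + (- w + w)              ≈⟨ trans (+-congˡ (-‿inverseˡ w)) (+-identityʳ c) ⟩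
      c                          ∎)

module Arithmetic where
  open import Data.Nat as ℕ using (ℕ; zero; suc; pred; _+_; _*_; _^_; _<_; z≤n; s≤s; z<s; NonZero)
  open import Data.Nat.Properties
  open import Data.Nat.Divisibility
  open import Data.Nat.GCD using (gcd; gcd[m,n]∣m; gcd[m,n]∣n; gcd[m,n]≢0)
  open import Data.Nat.Primality
    using (Prime; prime[2]; euclidsLemma; prime?; prime⇒nonZero; prime⇒nonTrivial; ¬prime⇒composite)
  open import Data.Nat.Divisibility.Core using (hasNonTrivialDivisor)
  open import Data.Nat.Induction using (<-rec)
  open import Data.Product using (∃; ∃₂; _,_; _×_)
  open import Data.Sum using (inj₁; inj₂)
  open import Relation.Nullary using (¬_; yes; no)
  open import Relation.Nullary.Negation using (contradiction)
  open import Relation.Binary.PropositionalEquality as ≡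
    using (_≡_; refl; sym; trans; cong; cong₂; subst)
  open ≡.≡-Reasoning

  choose : ℕ → ℕ → ℕ
  choose n       zero    = 1
  choose zero    (suc k) = 0
  choose (suc n) (suc k) = choose n k + choose n (suc k)

  choose-1 : ∀ n → choose n 1 ≡ n
  choose-1 zero    = refl
  choose-1 (suc n) = cong suc (choose-1 n)

  absorption : ∀ n k → suc k * choose (suc n) (suc k) ≡ suc n * choose n k
  absorption zero    zero    = refl
  absorption zero    (suc k) = *-zeroʳ (suc (suc k))
  absorption (suc n) zero    = cong suc (trans (+-identityʳ _) (cong suc (trans (choose-1 n) (sym (*-identityʳ n)))))
  absorption (suc n) (suc k) = begin
    suc (suc k) * (C (suc n) (suc k) + C (suc n) (suc (suc k)))
      ≡⟨ *-distribˡ-+ (suc (suc k)) (C (suc n) (suc k)) (C (suc n) (suc (suc k))) ⟩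
    suc (suc k) * C (suc n) (suc k) + suc (suc k) * C (suc n) (suc (suc k))
      ≡⟨ cong₂ _+_ (cong (C (suc n) (suc k) +_) (absorption n k)) (absorption n (suc k)) ⟩
    (C (suc n) (suc k) + suc n * C n k) + suc n * C n (suc k)
      ≡⟨ +-assoc (C (suc n) (suc k)) _ _ ⟩
    C (suc n) (suc k) + (suc n * C n k + suc n * C n (suc k))
      ≡⟨ cong (C (suc n) (suc k) +_) (sym (*-distribˡ-+ (suc n) (C n k) (C n (suc k)))) ⟩
    C (suc n) (suc k) + suc n * C (suc n) (suc k) ∎
    where
    C : ℕ → ℕ → ℕ
    C = choose

  module _ {p} (p-prime : Prime p) where
    private instance
      p≢0 : NonZero p
      p≢0 = prime⇒nonZero p-prime

    p>1 : 1 < p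
    p>1 = ℕ.nonTrivial⇒n>1 p ⦃ prime⇒nonTrivial p-prime ⦄

    ^-∣-coprime : ∀ j a b → p ^ j ∣ a * b → ¬ p ∣ a → p ^ j ∣ b
    ^-∣-coprime zero    a b _ _ = 1∣ b
    ^-∣-coprime (suc j) a b pʲ⁺¹∣ab p∤a with euclidsLemma a b p-prime (∣-trans (m∣m*n (p ^ j)) pʲ⁺¹∣ab)
    ... | inj₁ p∣a = contradiction p∣a p∤a
    ... | inj₂ (divides b′ refl) =
      subst (_∣ b′ * p) (*-comm (p ^ j) p) (*-monoˡ-∣ p (^-∣-coprime j a b′ pʲ∣ab′ p∤a))
      where
      pʲ∣ab′ : p ^ j ∣ a * b′
      pʲ∣ab′ = *-cancelˡ-∣ p (subst (p * p ^ j ∣_) (trans (sym (*-assoc a b′ p)) (*-comm (a * b′) p)) pʲ⁺¹∣ab)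

    p-part : ∀ N → 0 < N → ∃₂ λ k m → N ≡ p ^ k * m × ¬ p ∣ m
    p-part = <-rec _ split
      where
      split : ∀ N → (∀ {M} → M < N → 0 < M → ∃₂ λ k m → M ≡ p ^ k * m × ¬ p ∣ m) →
              0 < N → ∃₂ λ k m → N ≡ p ^ k * m × ¬ p ∣ m
      split N rec N>0 with p ∣? N
      ... | no p∤N = 0 , N , sym (+-identityʳ N) , p∤N
      ... | yes (divides zero refl) with () ← N>0
      ... | yes (divides M@(suc _) refl) with rec (m<m*n M p p>1) z<s
      ... | k , m , M≡ , p∤m = suc k , m , eq , p∤m
        where
        eq : M * p ≡ p ^ suc k * m
        eq = trans (cong (_* p) M≡) (trans (*-comm (p ^ k * m) p) (sym (*-assoc p (p ^ k) m)))

    ¬p^[k+1]∣ : ∀ k {m} → ¬ p ∣ m → ¬ p ^ suc k ∣ p ^ k * m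
    ¬p^[k+1]∣ k {m} p∤m pᵏ⁺¹∣ = p∤m (*-cancelˡ-∣ (p ^ k) ⦃ m^n≢0 p k ⦄
      (subst (_∣ p ^ k * m) (*-comm p (p ^ k)) pᵏ⁺¹∣))

    ¬p∣choose-below : ∀ k n → p ^ k ∣ suc n → ∀ j → j < p ^ k → ¬ p ∣ choose n j
    ¬p∣choose-below k n pᵏ∣n+1 zero    _ p∣1 = <-irrefl (sym (∣1⇒≡1 p∣1)) p>1
    ¬p∣choose-below k n pᵏ∣n+1 (suc j) j+1<pᵏ p∣Cn[j+1] =
      ¬p∣choose-below k n pᵏ∣n+1 j (<-trans (n<1+n j) j+1<pᵏ)
        (∣m+n∣m⇒∣n (subst (p ∣_) (+-comm (choose n j) _) p∣Cn+1[j+1]) p∣Cn[j+1])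
      where
      -- p ∣ C(n+1, j+1): otherwise p^k ∣ (j+1), by absorption
      p∣Cn+1[j+1] : p ∣ choose (suc n) (suc j)
      p∣Cn+1[j+1] with p ∣? choose (suc n) (suc j)
      ... | yes p∣ = p∣
      ... | no p∤ = contradiction (∣⇒≤ pᵏ∣j+1) (<⇒≱ j+1<pᵏ)
        where
        pᵏ∣j+1 : p ^ k ∣ suc j
        pᵏ∣j+1 = ^-∣-coprime k (choose (suc n) (suc j)) (suc j)
          (subst (p ^ k ∣_) (trans (sym (absorption n j)) (*-comm (suc j) _)) (∣m⇒∣m*n _ pᵏ∣n+1))
          p∤

    ¬p∣choose : ∀ k m → ¬ p ∣ m → ¬ p ∣ choose (p ^ k * m) (p ^ k)
    ¬p∣choose k m p∤m = subst (λ N → ¬ p ∣ choose N q) (suc-pred N)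
                          (subst (λ Q → ¬ p ∣ choose (suc (pred N)) Q) (suc-pred q) at-succ)
      where
      q N : ℕ
      q = p ^ k
      N = q * m
      instance
        q≢0 : NonZero q
        q≢0 = m^n≢0 p k
        m≢0 : NonZero m
        m≢0 = ℕ.≢-nonZero (λ { refl → p∤m (p ∣0) })
        N≢0 : NonZero N
        N≢0 = m*n≢0 q m
      n q′ : ℕ
      n = pred N
      q′ = pred q
      factor : choose (suc n) (suc q′) ≡ m * choose n q′
      factor = *-cancelˡ-≡ _ _ q (begin
        q * choose (suc n) (suc q′)      ≡⟨ cong (_* choose (suc n) (suc q′)) (sym (suc-pred q)) ⟩
        suc q′ * choose (suc n) (suc q′) ≡⟨ absorption n q′ ⟩
        suc n * choose n q′              ≡⟨ cong (_* choose n q′) (suc-pred N) ⟩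
        q * m * choose n q′              ≡⟨ *-assoc q m _ ⟩
        q * (m * choose n q′)            ∎)
      at-succ : ¬ p ∣ choose (suc n) (suc q′)
      at-succ p∣ with euclidsLemma m (choose n q′) p-prime (subst (p ∣_) factor p∣)
      ... | inj₁ p∣m = p∤m p∣m
      ... | inj₂ p∣C = ¬p∣choose-below k n (subst (q ∣_) (sym (suc-pred N)) (∣m⇒∣m*n m ∣-refl)) q′
                         (subst (q′ <_) (suc-pred q) (n<1+n q′)) p∣C

  prime-factor : ∀ d → 1 < d → ∃ λ p → Prime p × p ∣ d
  prime-factor = <-rec _ go
    where
    go : ∀ d → (∀ {e} → e < d → 1 < e → ∃ λ p → Prime p × p ∣ e) → 1 < d → ∃ λ p → Prime p × p ∣ d
    go d rec 1<d with prime? d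
    ... | yes d-prime = d , d-prime , ∣-refl
    ... | no ¬d-prime with ¬prime⇒composite ⦃ ℕ.n>1⇒nonTrivial 1<d ⦄ ¬d-prime
    ... | hasNonTrivialDivisor {e} e<d e∣d with rec e<d (ℕ.nonTrivial⇒n>1 e)
    ... | p , p-prime , p∣e = p , p-prime , ∣-trans p∣e e∣d

  -- Local-to-global: a set of numbers closed under gcd that contains, for
  -- every prime p, a number prime to p, contains 1.  (Repeatedly replace a
  -- member d > 1 by its gcd with a member prime to some prime factor of d.)
  gcd-descent : ∀ {ℓ} (D : ℕ → Set ℓ) →
                (∀ m n → D m → D n → D (gcd m n)) →
                (∀ p → Prime p → ∃ λ c → D c × ¬ p ∣ c) →
                D 1
  gcd-descent D D-gcd local with local 2 prime[2]
  ... | zero    , _  , 2∤0 = contradiction (2 ∣0) 2∤0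
  ... | suc c , Dc , _ = <-rec (λ d → 0 < d → D d → D 1) go (suc c) z<s Dc
    where
    go : ∀ d → (∀ {e} → e < d → 0 < e → D e → D 1) → 0 < d → D d → D 1
    go (suc zero) rec _ Dd = Dd
    go d@(suc (suc _)) rec _ Dd with prime-factor d (s≤s (s≤s z≤n))
    ... | p , p-prime , p∣d with local p p-prime
    ... | c , Dc , p∤c = rec g<d g>0 (D-gcd d c Dd Dc)
      where
      g : ℕ
      g = gcd d c
      g>0 : 0 < g
      g>0 = ℕ.>-nonZero⁻¹ g ⦃ ℕ.≢-nonZero (gcd[m,n]≢0 d c (inj₁ (λ ()))) ⦄
      g<d : g < d
      g<d = ≤∧≢⇒< (∣⇒≤ (gcd[m,n]∣m d c)) (λ g≡d → p∤c (∣-trans p∣d (subst (_∣ c) g≡d (gcd[m,n]∣n d c))))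

module Subsets where
  open Counting using (count; count-cong; count-none)
  open Arithmetic using (choose)
  open import Data.Bool using (Bool; true; false; if_then_else_)
  open import Data.Nat as ℕ using (ℕ; zero; suc; _+_; _≡ᵇ_)
  open import Data.Nat.Properties using (+-comm; +-assoc)
  open import Data.Fin using (Fin; zero; suc; _↑ˡ_; _↑ʳ_; splitAt; join)
  open import Data.Fin.Properties using (splitAt-↑ˡ; splitAt-↑ʳ; join-splitAt)
  open import Data.Sum using (_⊎_; inj₁; inj₂)
  open import Relation.Binary.PropositionalEquality
    using (_≡_; refl; sym; trans; cong; cong₂)

  -- 2ⁿ, unfolded so that Fin (#subsets (n+1)) splits as two copies of Fin (#subsets n)
  #subsets : ℕ → ℕ
  #subsets zero    = 1
  #subsets (suc n) = #subsets n + #subsets n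

  -- the code of a subset: its first element decides which half it lies in
  code : ∀ {n} → (Fin n → Bool) → Fin (#subsets n)
  code {zero}  s = zero
  code {suc n} s =
    if s zero then #subsets n ↑ʳ code (λ y → s (suc y)) else code (λ y → s (suc y)) ↑ˡ #subsets n

  members : ∀ {n} → Fin (#subsets n) → Fin n → Bool
  members-half : ∀ {n} → Fin (#subsets n) ⊎ Fin (#subsets n) → Fin (suc n) → Bool
  members {zero}  i ()
  members {suc n} i = members-half (splitAt (#subsets n) i)
  members-half (inj₁ j) zero    = false
  members-half (inj₁ j) (suc y) = members j y
  members-half (inj₂ j) zero    = true
  members-half (inj₂ j) (suc y) = members j y

  code-cong : ∀ {n} {s t : Fin n → Bool} → (∀ y → s y ≡ t y) → code s ≡ code t
  code-cong {zero} s≗t = refl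
  code-cong {suc n} {s} {t} s≗t
    rewrite s≗t zero | code-cong {n} {λ y → s (suc y)} {λ y → t (suc y)} (λ y → s≗t (suc y)) = refl

  members-code : ∀ {n} (s : Fin n → Bool) y → members (code s) y ≡ s y
  members-code {suc n} s y with s zero in s₀
  members-code {suc n} s zero    | true  rewrite splitAt-↑ʳ (#subsets n) (#subsets n) (code (λ y → s (suc y))) = sym s₀
  members-code {suc n} s (suc y) | true  rewrite splitAt-↑ʳ (#subsets n) (#subsets n) (code (λ y → s (suc y))) = members-code (λ y → s (suc y)) y
  members-code {suc n} s zero    | false rewrite splitAt-↑ˡ (#subsets n) (code (λ y → s (suc y))) (#subsets n) = sym s₀
  members-code {suc n} s (suc y) | false rewrite splitAt-↑ˡ (#subsets n) (code (λ y → s (suc y))) (#subsets n) = members-code (λ y → s (suc y)) y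

  rejoin : ∀ m {i : Fin (m + m)} {x} → splitAt m i ≡ x → join m m x ≡ i
  rejoin m {i} split = trans (sym (cong (join m m) split)) (join-splitAt m m i)

  code-members : ∀ n (i : Fin (#subsets n)) → code {n} (members {n} i) ≡ i
  code-members zero    zero = refl
  code-members (suc n) i with splitAt (#subsets n) i in split
  ... | inj₁ j = trans (cong (_↑ˡ #subsets n) (code-members n j)) (rejoin (#subsets n) split)
  ... | inj₂ j = trans (cong (#subsets n ↑ʳ_) (code-members n j)) (rejoin (#subsets n) split)

  count-++ : ∀ a b (f : Fin (a + b) → Bool) →
             count f ≡ count (λ i → f (i ↑ˡ b)) + count (λ j → f (a ↑ʳ j))
  count-++ zero    b f = refl
  count-++ (suc a) b f = trans (cong ((if f zero then 1 else 0) +_) (count-++ a b (λ i → f (suc i))))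
                              (sym (+-assoc (if f zero then 1 else 0) _ _))

  size : ∀ {n} → Fin (#subsets n) → ℕ
  size {n} i = count (members {n} i)

  count-size : ∀ n k → count {#subsets n} (λ i → size {n} i ≡ᵇ k) ≡ choose n k
  count-size zero    zero    = refl
  count-size zero    (suc k) = refl
  count-size (suc n) k =
    trans (count-++ (#subsets n) (#subsets n) (λ i → size {suc n} i ≡ᵇ k))
          (trans (cong₂ _+_ (count-cong (λ j → cong (λ z → count (members-half {n} z) ≡ᵇ k) (splitAt-↑ˡ (#subsets n) j (#subsets n))))
                            (count-cong (λ j → cong (λ z → count (members-half {n} z) ≡ᵇ k) (splitAt-↑ʳ (#subsets n) (#subsets n) j))))
                 (pascal k))
    where
    -- subsets avoiding 0, plus subsets containing 0
    pascal : ∀ k → count (λ j → size {n} j ≡ᵇ k) + count (λ j → suc (size {n} j) ≡ᵇ k) ≡ choose (suc n) k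
    pascal zero    = cong₂ _+_ (count-size n zero) (count-none {b = λ j → suc (size {n} j) ≡ᵇ zero} (λ j → refl))
    pascal (suc k) = trans (cong₂ _+_ (count-size n (suc k)) (count-size n k)) (+-comm (choose n (suc k)) (choose n k))

module FiniteActions {N M} (G : FiniteGroups.FinGroup N)
  (act : Fin N → Fin M → Fin M)
  (act-e  : ∀ i → act (FiniteGroups.FinGroup.e G) i ≡ i)
  (act-op : ∀ g h i → act (FiniteGroups.FinGroup.op G g h) i ≡ act g (act h i)) where
  open Counting
  open ℕSum using (_⊙_)
  open FiniteGroups
  open FinGroup G
  open import Data.Bool using (Bool; true; false; _∧_)
  open import Data.Nat using (_*_)
  open import Data.Nat.Divisibility using (_∣_; _∣0)
  open import Data.Fin using (_≟_)
  open import Data.Fin.Properties using (any?)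
  open import Data.Product using (∃; _,_)
  open import Relation.Nullary using (yes; no; does)
  open import Relation.Nullary.Decidable using (dec-true; dec-false; does-⇔)
  open import Function.Bundles using (mk⇔)
  open import Relation.Binary.PropositionalEquality as ≡
    using (refl; sym; trans; cong; subst)
  open ≡.≡-Reasoning

  back : ∀ g i → act (inv g) (act g i) ≡ i
  back g i = trans (sym (act-op (inv g) g i)) (trans (cong (λ z → act z i) (inverseˡ g)) (act-e i))

  act-injective : ∀ g {i j} → act g i ≡ act g j → i ≡ j
  act-injective g {i} {j} gi≡gj = trans (sym (back g i)) (trans (cong (act (inv g)) gi≡gj) (back g j))

  orbit : Fin M → Fin M → Bool
  orbit i j = does (any? (λ g → act g i ≟ j))

  orbit-intro : ∀ g i j → act g i ≡ j → orbit i j ≡ true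
  orbit-intro g i j gi≡j = dec-true (any? (λ g → act g i ≟ j)) (g , gi≡j)

  orbit-elim : ∀ i j → orbit i j ≡ true → ∃ λ g → act g i ≡ j
  orbit-elim i j i~j with any? (λ g → act g i ≟ j)
  ... | yes witness = witness

  orbit-refl : ∀ i → orbit i i ≡ true
  orbit-refl i = orbit-intro e i i (act-e i)

  orbit-sym : ∀ i j → orbit i j ≡ true → orbit j i ≡ true
  orbit-sym i j i~j with orbit-elim i j i~j
  ... | g , refl = orbit-intro (inv g) _ _ (back g i)

  orbit-trans : ∀ i j l → orbit i j ≡ true → orbit j l ≡ true → orbit i l ≡ true
  orbit-trans i j l i~j j~l with orbit-elim i j i~j | orbit-elim j l j~l
  ... | g , refl | h , refl = orbit-intro (op h g) _ _ (act-op h g i)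

  transporters : Fin M → Fin M → Fin N → Bool
  transporters i j g = does (act g i ≟ j)

  stabilizer : Fin M → Fin N → Bool
  stabilizer i = transporters i i

  stabilizer-subgroup : ∀ i → IsSubgroup G (stabilizer i)
  stabilizer-subgroup i = record
    { e∈   = dec-true (act e i ≟ i) (act-e i)
    ; op∈  = λ a b a∈ b∈ → dec-true (act (op a b) i ≟ i)
               (trans (act-op a b i) (trans (cong (act a) (fixes b∈)) (fixes a∈)))
    ; inv∈ = λ a a∈ → dec-true (act (inv a) i ≟ i)
               (trans (cong (act (inv a)) (sym (fixes a∈))) (back a i))
    }
    where
    fixes : ∀ {g} → stabilizer i g ≡ true → act g i ≡ i
    fixes {g} g∈ with act g i ≟ i
    ... | yes gi≡i = gi≡i

  -- the transporters from i to a point of its orbit form a coset of the stabiliser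
  count-transporters : ∀ i j → count (transporters i j) ≡ orbit i j ⊙ count (stabilizer i)
  count-transporters i j with any? (λ g → act g i ≟ j)
  ... | yes (h , refl) = trans (count-permute (transporters i (act h i)) (translateˡ h)) (count-cong cancel)
    where
    cancel : ∀ g → does (act (op h g) i ≟ act h i) ≡ does (act g i ≟ i)
    cancel g = does-⇔
      (mk⇔ (λ hgi≡hi → act-injective h (trans (sym (act-op h g i)) hgi≡hi))
                            (λ gi≡i → trans (act-op h g i) (cong (act h) gi≡i))) (act (op h g) i ≟ act h i) (act g i ≟ i)
  ... | no ¬i~j = count-none (λ g → dec-false (act g i ≟ j) (λ gi≡j → ¬i~j (g , gi≡j)))

  orbit-stabilizer : ∀ i → count (orbit i) * count (stabilizer i) ≡ N
  orbit-stabilizer i = sym (begin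
    N                                                ≡⟨ sym (count-all {N} {λ _ → true} (λ _ → refl)) ⟩
    count {N} (λ _ → true)                           ≡⟨ count≡sum {N} _ ⟩
    sum {N} (λ g → 1)                                ≡⟨ ℕSum.sum-cong-≗ {N} (λ g → trans (sym (count-singleton (act g i))) (count≡sum (λ j → does (act g i ≟ j)))) ⟩
    sum {N} (λ g → sum (λ j → does (act g i ≟ j) ⊙ 1)) ≡⟨ ℕSum.∑-comm (λ g j → does (act g i ≟ j) ⊙ 1) ⟩
    sum (λ j → sum {N} (λ g → transporters i j g ⊙ 1)) ≡⟨ ℕSum.sum-cong-≗ (λ j → trans (sym (count≡sum (transporters i j))) (count-transporters i j)) ⟩
    sum (λ j → orbit i j ⊙ count (stabilizer i))     ≡⟨ sum-⊙ (orbit i) (count (stabilizer i)) ⟩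
    count (orbit i) * count (stabilizer i)           ∎)
    where open ℕSum using (sum)

  ∣-union-of-orbits : ∀ d (Q : Fin M → Bool) → (∀ i j → orbit i j ≡ true → Q j ≡ Q i) →
                      (∀ i → Q i ≡ true → d ∣ count (orbit i)) → d ∣ count Q
  ∣-union-of-orbits d Q Q-invariant d∣orbit = subst (d ∣_) (sym (count-by-classes Q)) (∣-sum d _ term)
    where
    open Representatives orbit orbit-refl orbit-sym orbit-trans

    -- within the orbit of i, Q holds everywhere or nowhere
    restrict : ∀ i → count (λ j → orbit i j ∧ Q j) ≡ Q i ⊙ count (orbit i)
    restrict i with Q i in Qi
    ... | true  = count-cong (λ j → on-orbit j (orbit i j) refl)
      where
      on-orbit : ∀ j b → orbit i j ≡ b → (orbit i j ∧ Q j) ≡ orbit i j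
      on-orbit j true  i~j = trans (cong (_∧ Q j) i~j) (trans (Q-invariant i j i~j) (trans Qi (sym i~j)))
      on-orbit j false i≁j = trans (cong (_∧ Q j) i≁j) (sym i≁j)
    ... | false = count-none (λ j → off-orbit j (orbit i j) refl)
      where
      off-orbit : ∀ j b → orbit i j ≡ b → (orbit i j ∧ Q j) ≡ false
      off-orbit j true  i~j = trans (cong (_∧ Q j) i~j) (trans (Q-invariant i j i~j) Qi)
      off-orbit j false i≁j = cong (_∧ Q j) i≁j

    term : ∀ i → d ∣ rep i ⊙ count (λ j → orbit i j ∧ Q j)
    term i rewrite restrict i with rep i | Q i in Qi
    ... | false | _     = d ∣0
    ... | true  | false = d ∣0
    ... | true  | true  = d∣orbit i Qi

-- Sylow's theorem (existence), by Wielandt's argument: G acts by left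
-- translation on its subsets of size p^k; there are C(p^k m, p^k) of them,
-- a number prime to p, so some orbit has size prime to p, and the stabiliser
-- of a subset in that orbit has order exactly p^k.
module Sylow {N} (G : FiniteGroups.FinGroup N) where
  open Counting
  open FiniteGroups
  open FinGroup G
  open Subsets
  open Arithmetic using (choose; ^-∣-coprime; ¬p∣choose)
  open import Data.Bool using (Bool; true; T)
  open import Data.Bool.Properties using (_≟_)
  import Data.Fin as Fin
  open import Data.Nat as ℕ using (ℕ; _*_; _^_; _≤_; _<_; _≡ᵇ_)
  open import Data.Nat.Properties using (≤-antisym; ≤-trans; ≤-reflexive; ≡ᵇ⇒≡; *-comm; m^n>0)
  open import Data.Nat.Divisibility using (_∣_; _∣?_; divides; ∣⇒≤)
  open import Data.Nat.Primality using (Prime; prime⇒nonZero)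
  open import Data.Fin.Properties using (any?)
  open import Data.Product using (∃; _×_; _,_)
  open import Relation.Nullary using (¬_; yes; no; _×-dec_; ¬?)
  open import Relation.Nullary.Negation using (contradiction)
  open import Relation.Binary.PropositionalEquality as ≡
    using (refl; sym; trans; cong; subst)

  translate : Fin N → Fin (#subsets N) → Fin (#subsets N)
  translate g i = code (λ y → members i (op (inv g) y))

  members-translate : ∀ g i y → members (translate g i) y ≡ members i (op (inv g) y)
  members-translate g i = members-code (λ y → members i (op (inv g) y))

  translate-e : ∀ i → translate e i ≡ i
  translate-e i = trans (code-cong (λ y → cong (members i) (trans (cong (λ z → op z y) ε⁻¹≈ε) (identityˡ y))))
                        (code-members N i)

  translate-op : ∀ g h i → translate (op g h) i ≡ translate g (translate h i)
  translate-op g h i = code-cong (λ y → trans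
    (cong (members i) (trans (cong (λ z → op z y) (⁻¹-anti-homo-∙ g h)) (assoc (inv h) (inv g) y)))
    (sym (members-translate h i (op (inv g) y))))

  size-translate : ∀ g i → size {N} (translate g i) ≡ size {N} i
  size-translate g i = trans (count-cong (members-translate g i)) (sym (count-permute (members i) (translateˡ (inv g))))

  open FiniteActions G translate translate-e translate-op

  module _ {p} (p-prime : Prime p) (k m : ℕ) (N≡ : N ≡ p ^ k * m) (p∤m : ¬ p ∣ m) where
    private
      q : ℕ
      q = p ^ k
      instance
        p≢0 : ℕ.NonZero p
        p≢0 = prime⇒nonZero p-prime

    Q : Fin (#subsets N) → Bool
    Q i = size {N} i ≡ᵇ q

    Q-invariant : ∀ i j → orbit i j ≡ true → Q j ≡ Q i
    Q-invariant i j i~j with orbit-elim i j i~j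
    ... | g , refl = cong (_≡ᵇ q) (size-translate g i)

    good-subset : ∃ λ i → Q i ≡ true × ¬ p ∣ count (orbit i)
    good-subset with any? (λ i → (Q i ≟ true) ×-dec ¬? (p ∣? count (orbit i)))
    ... | yes found = found
    ... | no none = contradiction (∣-union-of-orbits p Q Q-invariant all-divisible) ¬p∣#Q
      where
      ¬p∣#Q : ¬ p ∣ count Q
      ¬p∣#Q p∣ = ¬p∣choose p-prime k m p∤m (subst (λ n → p ∣ choose n q) N≡ (subst (p ∣_) (count-size N q) p∣))
      all-divisible : ∀ i → Q i ≡ true → p ∣ count (orbit i)
      all-divisible i Qi with p ∣? count (orbit i)
      ... | yes p∣ = p∣
      ... | no p∤ = contradiction (i , Qi , p∤) none

    -- the stabiliser S of a subset U of size q has at most q elements,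
    -- since g ↦ gx (for a fixed x ∈ U) maps S injectively into U
    stabilizer≤ : ∀ i → size {N} i ≡ q → count (stabilizer i) ≤ q
    stabilizer≤ i |U|≡q with count>0 (members {N} i) (subst (0 <_) (sym |U|≡q) (m^n>0 p k))
    ... | x , x∈U = ≤-trans (count-mono into-U) (≤-reflexive (trans (sym (count-permute (members {N} i) (translateʳ x))) |U|≡q))
      where
      into-U : ∀ g → stabilizer i g ≡ true → members {N} i (op g x) ≡ true
      into-U g g∈S with translate g i Fin.≟ i
      ... | yes gU≡U = trans (cong (λ U → members {N} U (op g x)) (sym gU≡U))
                             (trans (members-translate g i _) (trans (cong (members i) (cancelˡ g x)) x∈U))

    sylow : ∃ λ S → IsSubgroup G S × count S ≡ p ^ k
    sylow with good-subset
    ... | i , Qi , p∤orbit = stabilizer i , stabilizer-subgroup i , ≤-antisym (stabilizer≤ i |U|≡q) q≤|S|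
      where
      |U|≡q : size {N} i ≡ q
      |U|≡q = ≡ᵇ⇒≡ (size {N} i) q (subst T (sym Qi) _)
      -- |orbit| |S| = q m with p ∤ |orbit|, so q divides |S|
      q∣|S| : q ∣ count (stabilizer i)
      q∣|S| = ^-∣-coprime p-prime k (count (orbit i)) _
        (divides m (trans (orbit-stabilizer i) (trans N≡ (*-comm q m)))) p∤orbit
      |S|>0 : 0 < count (stabilizer i)
      |S|>0 = count>0-intro (stabilizer i) e (IsSubgroup.e∈ (stabilizer-subgroup i))
      q≤|S| : q ≤ count (stabilizer i)
      q≤|S| = ∣⇒≤ ⦃ ℕ.>-nonZero |S|>0 ⦄ q∣|S|

-- The image H′ of H in Aut A, when finite of order N, realised as a group on
-- Fin N through a list r of elements of H representing its N automorphisms.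
module ImageGroup {c ℓ a ℓa} (H : Group c ℓ) (A : AbelianGroup a ℓa)
  (act : Group.Carrier H → AbelianGroup.Carrier A → AbelianGroup.Carrier A)
  (isAction : IsAction H A act) {N} (image : HasOrder H A act (λ _ → ⊤) N) where
  open Counting using (count)
  open Enumerations using (enumerate)
  open FiniteGroups using (FinGroup; IsSubgroup)
  open import Data.Bool using (Bool; true)
  open import Level using (Lift; lift)
  open import Algebra.Structures using (IsGroup)
  open import Data.Product using (_,_; proj₁; proj₂)
  open import Data.Unit.Polymorphic using (tt)
  open import Relation.Binary.PropositionalEquality as ≡ using (_≡_)
  private module H = Group H
  open AbelianGroup A hiding (group)
    renaming (_∙_ to _+_; ε to 0#; _⁻¹ to -_; identityʳ to +-identityʳ)
  open IsAction isAction
  open import Relation.Binary.Reasoning.Setoid setoid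

  infix 4 _≃_
  _≃_ : H.Carrier → H.Carrier → Set _
  _≃_ = _~_ H A act

  ≃-refl : ∀ {g} → g ≃ g
  ≃-refl x = refl

  ≃-sym : ∀ {g h} → g ≃ h → h ≃ g
  ≃-sym g≃h x = sym (g≃h x)

  ≃-trans : ∀ {g h k} → g ≃ h → h ≃ k → g ≃ k
  ≃-trans g≃h h≃k x = trans (g≃h x) (h≃k x)

  ≈⇒≃ : ∀ {g h} → g H.≈ h → g ≃ h
  ≈⇒≃ g≈h x = act-cong g≈h refl

  ∙-≃ : ∀ {g g′ h h′} → g ≃ g′ → h ≃ h′ → g H.∙ h ≃ g′ H.∙ h′
  ∙-≃ {g} {g′} {h} {h′} g≃g′ h≃h′ x = begin
    act (g H.∙ h) x    ≈⟨ act-∙ g h x ⟩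
    act g (act h x)    ≈⟨ act-cong H.refl (h≃h′ x) ⟩
    act g (act h′ x)   ≈⟨ g≃g′ _ ⟩
    act g′ (act h′ x)  ≈⟨ sym (act-∙ g′ h′ x) ⟩
    act (g′ H.∙ h′) x  ∎

  ⁻¹-≃ : ∀ {g g′} → g ≃ g′ → g H.⁻¹ ≃ g′ H.⁻¹
  ⁻¹-≃ {g} {g′} g≃g′ x = begin
    act (g H.⁻¹) x                           ≈⟨ act-cong H.refl (sym (g′-undone x)) ⟩
    act (g H.⁻¹) (act g′ (act (g′ H.⁻¹) x)) ≈⟨ act-cong H.refl (sym (g≃g′ _)) ⟩
    act (g H.⁻¹) (act g (act (g′ H.⁻¹) x))  ≈⟨ sym (act-∙ _ _ _) ⟩
    act (g H.⁻¹ H.∙ g) (act (g′ H.⁻¹) x)    ≈⟨ trans (act-cong (H.inverseˡ g) refl) (act-ε _) ⟩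
    act (g′ H.⁻¹) x                          ∎
    where
    g′-undone : ∀ x → act g′ (act (g′ H.⁻¹) x) ≈ x
    g′-undone x = trans (sym (act-∙ g′ (g′ H.⁻¹) x)) (trans (act-cong (H.inverseʳ g′) refl) (act-ε x))

  r : Fin N → H.Carrier
  r = proj₁ image

  r-injective : ∀ i j → r i ≃ r j → i ≡ j
  r-injective = proj₁ (proj₂ (proj₂ image))

  idx : H.Carrier → Fin N
  idx h = proj₁ (proj₂ (proj₂ (proj₂ image)) h tt)

  idx-spec : ∀ h → h ≃ r (idx h)
  idx-spec h = proj₂ (proj₂ (proj₂ (proj₂ image)) h tt)

  idx-cong : ∀ {g h} → g ≃ h → idx g ≡ idx h
  idx-cong {g} {h} g≃h = r-injective _ _ (≃-trans (≃-sym (idx-spec g)) (≃-trans g≃h (idx-spec h)))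

  idx-r : ∀ i → idx (r i) ≡ i
  idx-r i = r-injective _ _ (≃-sym (idx-spec (r i)))

  r-idx : ∀ h → r (idx h) ≃ h
  r-idx h = ≃-sym (idx-spec h)

  private
    _·_ : Fin N → Fin N → Fin N
    i · j = idx (r i H.∙ r j)

    image-isGroup : IsGroup _≡_ _·_ (idx H.ε) (λ i → idx (r i H.⁻¹))
    image-isGroup = record
      { isMonoid = record
        { isSemigroup = record
          { isMagma = record { isEquivalence = ≡.isEquivalence ; ∙-cong = ≡.cong₂ _·_ }
          ; assoc = λ i j k → idx-cong (≃-trans (∙-≃ (r-idx _) ≃-refl)
                      (≃-trans (≈⇒≃ (H.assoc _ _ _)) (∙-≃ ≃-refl (idx-spec _))))
          }
        ; identity = (λ i → r-injective _ _ (≃-trans (r-idx _) (≃-trans (∙-≃ (r-idx _) ≃-refl) (≈⇒≃ (H.identityˡ _)))))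
                   , (λ i → r-injective _ _ (≃-trans (r-idx _) (≃-trans (∙-≃ ≃-refl (r-idx _)) (≈⇒≃ (H.identityʳ _)))))
        }
      ; inverse = (λ i → idx-cong (≃-trans (∙-≃ (r-idx _) ≃-refl) (≈⇒≃ (H.inverseˡ _))))
                , (λ i → idx-cong (≃-trans (∙-≃ ≃-refl (r-idx _)) (≈⇒≃ (H.inverseʳ _))))
      ; ⁻¹-cong = ≡.cong (λ i → idx (r i H.⁻¹))
      }

  G : FinGroup N
  G = record { isGroup = image-isGroup }

  open FinGroup G using (op; inv)

  idx-op : ∀ g h → idx (g H.∙ h) ≡ op (idx g) (idx h)
  idx-op g h = idx-cong (∙-≃ (idx-spec g) (idx-spec h))

  idx-inv : ∀ g → idx (g H.⁻¹) ≡ inv (idx g)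
  idx-inv g = idx-cong (⁻¹-≃ (idx-spec g))

  preimage : (Fin N → Bool) → H.Carrier → Set (L H A)
  preimage S h = Lift (L H A) (S (idx h) ≡ true)

  preimage-subgroup : ∀ {S} → IsSubgroup G S → IsImageSubgroup H A act (preimage S)
  preimage-subgroup {S} sub =
      (λ g h g≃h (lift g∈) → lift (≡.subst (λ i → S i ≡ true) (idx-cong g≃h) g∈))
    , lift e∈
    , (λ g h (lift g∈) (lift h∈) → lift (≡.subst (λ i → S i ≡ true) (≡.sym (idx-op g h)) (op∈ _ _ g∈ h∈)))
    , (λ g (lift g∈) → lift (≡.subst (λ i → S i ≡ true) (≡.sym (idx-inv g)) (inv∈ _ g∈)))
    where open IsSubgroup sub

  preimage-order : ∀ {S n} → count S ≡ n → HasOrder H A act (preimage S) n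
  preimage-order {S} ≡.refl with enumerate S
  ... | en , en∈ , en-inj , en-onto =
      (λ i → r (en i))
    , (λ i → lift (≡.subst (λ j → S j ≡ true) (≡.sym (idx-r (en i))) (en∈ i)))
    , (λ i j ri≃rj → en-inj i j (r-injective _ _ ri≃rj))
    , λ h (lift h∈) → let (i , en-i≡) = en-onto (idx h) h∈ in
        i , ≃-trans (idx-spec h) (≡.subst (λ j → r (idx h) ≃ r j) (≡.sym en-i≡) ≃-refl)

  α : Fin N → Carrier → Carrier
  α i = act (r i)

  α-isAction : IsAction (FinGroup.group G) A α
  α-isAction = record
    { act-cong = λ { ≡.refl x≈y → act-cong H.refl x≈y }
    ; act-ε    = λ x → trans (r-idx H.ε x) (act-ε x)
    ; act-∙    = λ i j x → trans (r-idx _ x) (act-∙ (r i) (r j) x)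
    ; act-hom  = λ i → act-hom (r i)
    }

  -- a cocycle vanishing on the kernel of the action only depends on the
  -- automorphism induced by its argument, and so descends to H′
  module Descend (f : H.Carrier → Carrier) (cocycle : IsCrossedHom H A act f)
           (f-kernel : ∀ k → k ≃ H.ε → f k ≈ 0#) where
    open Coboundaries H A act isAction using (act-0)
    private
      f-cong : ∀ {g h} → g H.≈ h → f g ≈ f h
      f-cong = proj₁ cocycle
      f-op : ∀ g h → f (g H.∙ h) ≈ f g + act g (f h)
      f-op = proj₂ cocycle

    f-resp : ∀ {g h} → g ≃ h → f g ≈ f h
    f-resp {g} {h} g≃h = sym (begin
      f h                                 ≈⟨ f-cong (H.sym g[g⁻¹h]≈h) ⟩
      f (g H.∙ (g H.⁻¹ H.∙ h))            ≈⟨ f-op g _ ⟩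
      f g + act g (f (g H.⁻¹ H.∙ h))      ≈⟨ ∙-congˡ (trans (act-cong H.refl (f-kernel _ g⁻¹h≃ε)) (act-0 g)) ⟩
      f g + 0#                            ≈⟨ +-identityʳ _ ⟩
      f g                                 ∎)
      where
      g[g⁻¹h]≈h : g H.∙ (g H.⁻¹ H.∙ h) H.≈ h
      g[g⁻¹h]≈h = H.trans (H.sym (H.assoc _ _ _)) (H.trans (H.∙-congʳ (H.inverseʳ g)) (H.identityˡ h))
      g⁻¹h≃ε : g H.⁻¹ H.∙ h ≃ H.ε
      g⁻¹h≃ε = ≃-trans (∙-≃ ≃-refl (≃-sym g≃h)) (≈⇒≃ (H.inverseˡ g))

    F : Fin N → Carrier
    F i = f (r i)

    F-cocycle : IsCrossedHom (FinGroup.group G) A α F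
    F-cocycle = (λ { ≡.refl → refl }) , λ i j → trans (f-resp (r-idx _)) (f-op (r i) (r j))

module Proof {c ℓ a ℓa} (H : Group c ℓ) (A : AbelianGroup a ℓa)
  (act : Group.Carrier H → AbelianGroup.Carrier A → AbelianGroup.Carrier A)
  (isAction : IsAction H A act)
  {N} (image : HasOrder H A act (λ _ → ⊤) N)
  (sylow-cyclic : SylowSubgroupsCyclic H A act)
  (f : Group.Carrier H → AbelianGroup.Carrier A) (cocycle : IsCrossedHom H A act f)
  (cyclic-zero : ∀ h → RestrictionZero H A act f h) where

  open Counting using (count)
  open FiniteGroups using (FinGroup; IsSubgroup; module Cosets)
  open ImageGroup H A act isAction image
  open Arithmetic using (p-part; ¬p^[k+1]∣; gcd-descent)
  open import Data.Bool using (true)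
  open import Data.Integer using (+_)
  open import Data.Nat as ℕ using (_*_; _^_)
  open import Data.Nat.Properties using (*-comm; *-cancelʳ-≡; m^n≢0)
  open import Data.Nat.Divisibility using (_∣_; divides)
  open import Data.Nat.Primality using (Prime; prime⇒nonZero)
  open import Data.Fin.Properties using (nonZeroIndex)
  open import Data.Product using (∃; _×_; _,_; proj₁; proj₂)
  open import Level using (lift)
  open import Relation.Nullary using (¬_)
  open import Relation.Binary.PropositionalEquality as ≡ using (_≡_)
  private module H = Group H
  open AbelianGroup A hiding (group)
    renaming (_∙_ to _+_; ε to 0#; _⁻¹ to -_; identityʳ to +-identityʳ)
  open IsAction isAction
  open import Relation.Binary.Reasoning.Setoid setoid

  -- f vanishes on the kernel: on ⟨k⟩ it is the coboundary of some x, and k fixes x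
  f-kernel : ∀ k → k ≃ H.ε → f k ≈ 0#
  f-kernel k k≃ε with cyclic-zero k
  ... | x , f≈δx = begin
    f k                     ≈⟨ proj₁ cocycle (H.sym (H.identityʳ k)) ⟩
    f (k H.∙ H.ε)           ≈⟨ f≈δx (+ 1) ⟩
    act (k H.∙ H.ε) x + - x ≈⟨ ∙-congʳ (trans (act-cong (H.identityʳ k) refl) (trans (k≃ε x) (act-ε x))) ⟩
    x + - x                 ≈⟨ inverseʳ x ⟩
    0#                      ∎

  open Descend f cocycle f-kernel using (f-resp; F; F-cocycle)
  open Coboundaries (FinGroup.group G) A α α-isAction using (KilledBy; killedBy-gcd)
  open Transfer G A α α-isAction F F-cocycle using (transfer)

  cyclic-coboundary : ∀ {S} → IsCyclicImageSubgroup H A act (preimage S) →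
                      ∃ λ x → ∀ s → S s ≡ true → F s ≈ α s x + - x
  cyclic-coboundary {S} (g , _ , generated) with cyclic-zero g
  ... | x , f≈δx = x , F≈δx
    where
    F≈δx : ∀ s → S s ≡ true → F s ≈ α s x + - x
    F≈δx s s∈S with generated (r s) (lift (≡.subst (λ i → S i ≡ true) (≡.sym (idx-r s)) s∈S))
    ... | n , rs≃gⁿ = begin
      f (r s)                   ≈⟨ f-resp rs≃gⁿ ⟩
      f (pow H A g n)           ≈⟨ f≈δx n ⟩
      act (pow H A g n) x + - x ≈⟨ ∙-congʳ (sym (rs≃gⁿ x)) ⟩
      α s x + - x               ∎

  sylow-index : ∀ {p} → Prime p → ∀ k m → N ≡ p ^ k * m → ¬ p ∣ m →
                ∀ {S} → IsSubgroup G S → count S ≡ p ^ k →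
                ∃ λ c → KilledBy F c × ¬ p ∣ c
  sylow-index {p} p-prime k m N≡ p∤m {S} sub |S|≡pᵏ =
    index , transfer sub (proj₁ coboundary) (proj₂ coboundary) , ≡.subst (λ i → ¬ p ∣ i) (≡.sym index≡m) p∤m
    where
    open Cosets G sub using (index; lagrange)
    pᵏ∣N : p ^ k ∣ N
    pᵏ∣N = divides m (≡.trans N≡ (*-comm (p ^ k) m))
    pᵏ⁺¹∤N : ¬ p ^ ℕ.suc k ∣ N
    pᵏ⁺¹∤N = ≡.subst (λ n → ¬ p ^ ℕ.suc k ∣ n) (≡.sym N≡) (¬p^[k+1]∣ p-prime k p∤m)
    coboundary : ∃ λ x → ∀ s → S s ≡ true → F s ≈ α s x + - x
    coboundary = cyclic-coboundary (sylow-cyclic N image p p-prime k pᵏ∣N pᵏ⁺¹∤N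
                   (preimage S) (preimage-subgroup sub) (preimage-order |S|≡pᵏ))
    index≡m : index ≡ m
    index≡m = *-cancelʳ-≡ index m (p ^ k) ⦃ m^n≢0 p k ⦃ prime⇒nonZero p-prime ⦄ ⦄
      (≡.trans (≡.cong (index *_) (≡.sym |S|≡pᵏ)) (≡.trans lagrange (≡.trans N≡ (*-comm (p ^ k) m))))

  local : ∀ p → Prime p → ∃ λ c → KilledBy F c × ¬ p ∣ c
  local p p-prime =
    let k , m , N≡ , p∤m = p-part p-prime N (ℕ.>-nonZero⁻¹ N ⦃ nonZeroIndex (idx H.ε) ⦄)
        S , sub , |S|≡pᵏ = Sylow.sylow G p-prime k m N≡ p∤m
    in sylow-index p-prime k m N≡ p∤m sub |S|≡pᵏ

  theorem : ClassZero H A act f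
  theorem = pull-back (gcd-descent (KilledBy F) (killedBy-gcd F) local)
    where
    pull-back : KilledBy F 1 → ClassZero H A act f
    pull-back (y , F≈δy) = y , λ g → begin
      f g                    ≈⟨ f-resp (idx-spec g) ⟩
      F (idx g)              ≈⟨ sym (+-identityʳ _) ⟩
      F (idx g) + 0#         ≈⟨ F≈δy (idx g) ⟩
      α (idx g) y + - y      ≈⟨ ∙-congʳ (sym (idx-spec g y)) ⟩
      act g y + - y          ∎

lemma2p4p5 : ∀ {c ℓ a ℓa} (H : Group c ℓ) (A : AbelianGroup a ℓa)
    (act : Group.Carrier H → AbelianGroup.Carrier A → AbelianGroup.Carrier A) →
    IsAction H A act →
    ImageFinite H A act →
    SylowSubgroupsCyclic H A act →
    (f : Group.Carrier H → AbelianGroup.Carrier A) →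
    IsCrossedHom H A act f →
    (∀ h → RestrictionZero H A act f h) →
    ClassZero H A act f
lemma2p4p5 H A act isAction (N , image) sylow-cyclic f cocycle cyclic-zero =
  Proof.theorem H A act isAction image sylow-cyclic f cocycle cyclic-zero
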